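{- If a graph $G$ (finite or infinite) has a cycle of finite length $n\geq3$, then $\mathcal{F}(G)$ contains $K_n$ as a subgraph.
   Context: Graphs are simple and may be infinite. A forest of $G$ is an acyclic subgraph; a maximal forest is a forest of $G$ not properly contained in another forest of $G$. The forest graph $\mathcal{F}(G)$ has as vertices the maximal forests of $G$, two being adjacent iff $F_2=F_1-e+f$ for some edges $e\in F_1$, $f\notin F_1$. -}

module Defs where

open import Level using (0ℓ) renaming (suc to lsuc)
open import Data.Nat using (ℕ; zero; suc; _≤_)
open import Data.Fin using (Fin; inject₁; fromℕ) renaming (zero to fzero; suc to fsuc)
open import Data.Product using (Σ; Σ-syntax; ∃; _×_; _,_)
open import Data.Sum using (_⊎_)
open import Data.Empty using (⊥)
open import Relation.Nullary using (¬_)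
open import Relation.Binary.PropositionalEquality using (_≡_; _≢_)
open import Function.Definitions using (Injective)
open import Function.Bundles using (_⇔_)

record Graph : Set₁ where
  field
    V      : Set
    _~_    : V → V → Set
    ~-sym  : ∀ {u v} → u ~ v → v ~ u
    ~-irr  : ∀ {u} → ¬ (u ~ u)

-- A set of edges on vertex set V, represented as a symmetric relation
-- (the unordered edge {u,v} is present iff F u v, equivalently F v u).
EdgeSet : Set → Set₁
EdgeSet V = V → V → Set

SamePair : {V : Set} → V → V → V → V → Set
SamePair a b u v = (a ≡ u × b ≡ v) ⊎ (a ≡ v × b ≡ u)

_⊆ₑ_ : {V : Set} → EdgeSet V → EdgeSet V → Set
F ⊆ₑ F' = ∀ u v → F u v → F' u v

_≐ₑ_ : {V : Set} → EdgeSet V → EdgeSet V → Set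
F ≐ₑ F' = ∀ u v → F u v ⇔ F' u v

CycleOfLength : {V : Set} → EdgeSet V → ℕ → Set
CycleOfLength {V} R zero = ⊥
CycleOfLength {V} R (suc m) =
  Σ[ v ∈ (Fin (suc m) → V) ]
    Injective _≡_ _≡_ v
    × (∀ (i : Fin m) → R (v (inject₁ i)) (v (fsuc i)))
    × R (v (fromℕ m)) (v fzero)

HasCycle : {V : Set} → EdgeSet V → Set
HasCycle R = Σ[ n ∈ ℕ ] (3 ≤ n × CycleOfLength R n)

module _ (G : Graph) where
  open Graph G

  -- A forest of G (edge set of an acyclic subgraph; vertices are irrelevant
  -- for maximality since isolated vertices never create cycles).
  IsForest : EdgeSet V → Set
  IsForest F = F ⊆ₑ _~_ × (∀ {u v} → F u v → F v u) × ¬ HasCycle F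

  IsMaximalForest : EdgeSet V → Set₁
  IsMaximalForest F = IsForest F × (∀ F' → IsForest F' → F ⊆ₑ F' → F' ⊆ₑ F)

  ForestAdj : EdgeSet V → EdgeSet V → Set
  ForestAdj F₁ F₂ =
    Σ[ u ∈ V ] Σ[ v ∈ V ] Σ[ x ∈ V ] Σ[ y ∈ V ]
      F₁ u v × x ~ y × ¬ F₁ x y ×
      (∀ a b → F₂ a b ⇔ ((F₁ a b × ¬ SamePair a b u v) ⊎ SamePair a b x y))

  ForestGraphContainsK : ℕ → Set₁
  ForestGraphContainsK n =
    Σ[ T ∈ (Fin n → EdgeSet V) ]
      (∀ i → IsMaximalForest (T i))
      × (∀ i j → i ≢ j → ¬ (T i ≐ₑ T j))
      × (∀ i j → i ≢ j → ForestAdj (T i) (T j))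

Zorn : Set₂
Zorn = (A : Set₁) (_≤_ : A → A → Set) →
       (∀ {x} → x ≤ x) → (∀ {x y z} → x ≤ y → y ≤ z → x ≤ z) →
       A →
       ((C : A → Set₁) → (∀ {x y} → C x → C y → (x ≤ y) ⊎ (y ≤ x)) →
          Σ[ u ∈ A ] (∀ {x} → C x → x ≤ u)) →
       Σ[ m ∈ A ] (∀ y → m ≤ y → y ≤ m)

module Submission where

-- Write C for the given cycle, with vertices w 0, …, w (n ∸ 1) and edges e_k = w k w (k + 1)
-- (indices modulo n). By Zorn's lemma there is a forest H of G that is maximal among the
-- forests joining no two distinct vertices of C. For every t the set T t = H ∪ (C − e_t) is a
-- forest, because C − e_t is a path and each component of H contains at most one of its
-- vertices. It is a maximal forest: if a forest F ⊇ T t had a further edge ab, then ab is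
-- not on C (otherwise F ⊇ C), and H + ab still joins no two vertices of C, since together with
-- the path C − e_t such a connection would close a cycle in F; this contradicts the maximality
-- of H. Finally T s = T t − e_s + e_t, so the n forests T t are pairwise adjacent in 𝓕(G).
-- Excluded middle is used to decide membership in edge sets and reachability.

open import Defs
open import Level using (0ℓ; Lift; lift; lower) renaming (suc to lsuc)
open import Axiom.ExcludedMiddle using (ExcludedMiddle)
open import Data.Nat using (ℕ; zero; suc; _+_; _∸_; _≤_; _<_; s≤s; z≤n; _≟_)
open import Data.Nat.Properties
  using ( +-comm; +-assoc; +-suc; +-identityʳ; m∸n+n≡m; 1+n≢0; ≤-refl; ≤-trans; ≤-pred; n≤1+n
        ; m≤n⇒m<n∨m≡n; ≤∧≢⇒<; <⇒≤; <⇒≢; <-irrefl; <-trans; <-≤-trans; <-cmp)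
open import Data.Nat.DivMod using (_%_; _mod_; m%n<n; m<n⇒m%n≡m; [m+n]%n≡m%n; %-distribˡ-+; m%n%n≡m%n)
open import Data.Fin using (Fin; toℕ; inject₁; fromℕ; fromℕ<) renaming (zero to fzero; suc to fsuc)
open import Data.Fin.Properties
  using (suc-injective; fromℕ≢inject₁; toℕ-injective; toℕ-fromℕ<; toℕ<n; toℕ-inject₁; toℕ-fromℕ)
open import Data.Product using (Σ-syntax; ∃₂; _×_; _,_; proj₁; proj₂)
open import Data.Sum using (_⊎_; inj₁; inj₂)
open import Data.Empty using (⊥; ⊥-elim)
open import Function.Base using (_∘_)
open import Function.Bundles using (_⇔_; mk⇔; Equivalence)
open import Function.Definitions using (Injective)
open import Relation.Nullary using (¬_; Dec; yes; no)
open import Relation.Nullary.Decidable using (map′; True; toWitness; fromWitness)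
open import Relation.Binary using (Rel; Symmetric; tri<; tri≈; tri>)
open import Relation.Binary.PropositionalEquality
  using (_≡_; _≢_; refl; sym; trans; cong; subst; subst₂; module ≡-Reasoning)
open import Relation.Binary.Construct.Closure.ReflexiveTransitive
  using (Star; ε; _◅_; _◅◅_; fold; reverse; return)
  renaming (map to Star-map)
open import Relation.Binary.Construct.Union as Union using (_∪_)

-- Walks, bypasses and cycles

module _ {V : Set} where

  SamePair-swap : ∀ {a b u v : V} → SamePair a b u v → SamePair b a u v
  SamePair-swap (inj₁ (refl , refl)) = inj₂ (refl , refl)
  SamePair-swap (inj₂ (refl , refl)) = inj₁ (refl , refl)

  SamePair-swapʳ : ∀ {a b u v : V} → SamePair a b u v → SamePair a b v u
  SamePair-swapʳ (inj₁ (refl , refl)) = inj₂ (refl , refl)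
  SamePair-swapʳ (inj₂ (refl , refl)) = inj₁ (refl , refl)

  SamePair-sym : ∀ {a b u v : V} → SamePair a b u v → SamePair u v a b
  SamePair-sym (inj₁ (refl , refl)) = inj₁ (refl , refl)
  SamePair-sym (inj₂ (refl , refl)) = inj₂ (refl , refl)

  SamePair-trans : ∀ {a b u v x y : V} → SamePair a b u v → SamePair u v x y → SamePair a b x y
  SamePair-trans (inj₁ (refl , refl)) q = q
  SamePair-trans (inj₂ (refl , refl)) q = SamePair-swap q

  SamePair-transport : {R : Rel V 0ℓ} → Symmetric R → ∀ {a b x y} → R a b → SamePair x y a b → R x y
  SamePair-transport sym-R r (inj₁ (refl , refl)) = r
  SamePair-transport sym-R r (inj₂ (refl , refl)) = sym-R r

  _∖⟨_,_⟩ : Rel V 0ℓ → V → V → Rel V 0ℓ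
  (R ∖⟨ c , d ⟩) a b = R a b × ¬ SamePair a b c d

  ∖-symmetric : {R : Rel V 0ℓ} → Symmetric R → ∀ {c d} → Symmetric (R ∖⟨ c , d ⟩)
  ∖-symmetric sym-R (r , r≉cd) = sym-R r , r≉cd ∘ SamePair-swap

  Star-transport : {R : Rel V 0ℓ} (Q : V → Set) → (∀ {a b} → R a b → Q a → Q b) →
                   ∀ {a b} → Star R a b → Q a → Q b
  Star-transport Q step = fold (λ a b → Q a → Q b) (λ r f q → f (step r q)) (λ q → q)

  -- For symmetric irreflexive R, having a bypass is the same as having a cycle.
  Bypass : Rel V 0ℓ → V → V → Set
  Bypass R c d = R c d × Star (R ∖⟨ c , d ⟩) c d

  bypass-mono : {R R′ : Rel V 0ℓ} → (∀ {a b} → R a b → R′ a b) →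
                ∀ {c d} → Bypass R c d → Bypass R′ c d
  bypass-mono R⊆R′ (rcd , detour) = R⊆R′ rcd , Star-map (λ (r , r≉cd) → R⊆R′ r , r≉cd) detour

  bypass-swap : {R : Rel V 0ℓ} → Symmetric R → ∀ {c d} → Bypass R c d → Bypass R d c
  bypass-swap sym-R (rcd , detour) =
    sym-R rcd , reverse (∖-symmetric sym-R) (Star-map (λ (r , r≉cd) → r , r≉cd ∘ SamePair-swapʳ) detour)

  hasCycle-mono : {R R′ : Rel V 0ℓ} → R ⊆ₑ R′ → HasCycle R → HasCycle R′
  hasCycle-mono R⊆R′ (suc k , 3≤n , v , v-inj , steps , closing) =
    suc k , 3≤n , v , v-inj , (λ i → R⊆R′ _ _ (steps i)) , R⊆R′ _ _ closing

  star-along : {R : Rel V 0ℓ} (k : ℕ) (f : Fin (suc k) → V) →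
               (∀ (i : Fin k) → R (f (inject₁ i)) (f (fsuc i))) → Star R (f fzero) (f (fromℕ k))
  star-along zero f steps = ε
  star-along (suc k) f steps = steps fzero ◅ star-along k (λ j → f (fsuc j)) (λ i → steps (fsuc i))

  hasCycle⇒bypass : {R : Rel V 0ℓ} → Symmetric R → HasCycle R → ∃₂ (Bypass R)
  hasCycle⇒bypass sym-R (suc m@(suc (suc _)) , s≤s (s≤s (s≤s z≤n)) , v , v-inj , steps , closing) =
    v fzero , v (fromℕ m) , sym-R closing , star-along m v (λ i → steps i , avoids i)
    where
      avoids : ∀ (i : Fin m) → ¬ SamePair (v (inject₁ i)) (v (fsuc i)) (v fzero) (v (fromℕ m))
      avoids fzero    (inj₁ (_ , e)) with () ← v-inj e
      avoids (fsuc i) (inj₁ (e , _)) with () ← v-inj e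
      avoids i        (inj₂ (e , _)) = fromℕ≢inject₁ (sym (v-inj e))

  record SimplePath (R : Rel V 0ℓ) (a b : V) : Set where
    constructor simplePath
    field
      length    : ℕ
      vertex    : Fin (suc length) → V
      injective : Injective _≡_ _≡_ vertex
      steps     : ∀ (i : Fin length) → R (vertex (inject₁ i)) (vertex (fsuc i))
      starts    : vertex fzero ≡ a
      ends      : vertex (fromℕ length) ≡ b

  simplePath-suffix : {R : Rel V 0ℓ} (k : ℕ) (f : Fin (suc k) → V) → Injective _≡_ _≡_ f →
                      (∀ (i : Fin k) → R (f (inject₁ i)) (f (fsuc i))) →
                      (i : Fin (suc k)) → SimplePath R (f i) (f (fromℕ k))
  simplePath-suffix k f f-inj steps fzero = simplePath k f f-inj steps refl refl
  simplePath-suffix (suc k) f f-inj steps (fsuc i) =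
    simplePath-suffix k (λ j → f (fsuc j)) (λ e → suc-injective (f-inj e)) (λ j → steps (fsuc j)) i

  module _ (decide : (P : Set) → Dec P) where

    -- Shortcut the walk at the first repeated vertex.
    star⇒simplePath : {R : Rel V 0ℓ} → ∀ {a b} → Star R a b → SimplePath R a b
    star⇒simplePath {a = a} ε = simplePath 0 (λ _ → a) (λ { {fzero} {fzero} _ → refl }) (λ ()) refl refl
    star⇒simplePath {R} {a} (r ◅ rs) with star⇒simplePath rs
    ... | simplePath k f f-inj steps starts ends with decide (Σ[ i ∈ Fin (suc k) ] f i ≡ a)
    ...   | yes (i , fi≡a) = subst₂ (SimplePath R) fi≡a ends (simplePath-suffix k f f-inj steps i)
    ...   | no a∉f = simplePath (suc k) g g-inj g-steps refl ends
      where
        g : Fin (suc (suc k)) → V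
        g fzero    = a
        g (fsuc j) = f j
        g-inj : Injective _≡_ _≡_ g
        g-inj {fzero}  {fzero}  _ = refl
        g-inj {fzero}  {fsuc j} e = ⊥-elim (a∉f (j , sym e))
        g-inj {fsuc i} {fzero}  e = ⊥-elim (a∉f (i , e))
        g-inj {fsuc i} {fsuc j} e = cong fsuc (f-inj e)
        g-steps : ∀ (i : Fin (suc k)) → R (g (inject₁ i)) (g (fsuc i))
        g-steps fzero    = subst (R a) (sym starts) r
        g-steps (fsuc i) = steps i

    bypass⇒hasCycle : {R : Rel V 0ℓ} → (∀ {a} → ¬ R a a) → Symmetric R →
                      ∀ {c d} → Bypass R c d → HasCycle R
    bypass⇒hasCycle irr sym-R (rcd , detour) with star⇒simplePath detour
    ... | simplePath zero _ _ _ refl refl = ⊥-elim (irr rcd)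
    ... | simplePath (suc zero) _ _ steps refl refl = ⊥-elim (proj₂ (steps fzero) (inj₁ (refl , refl)))
    ... | simplePath (suc (suc k)) f f-inj steps refl refl =
      suc (suc (suc k)) , s≤s (s≤s (s≤s z≤n)) , f , f-inj , (λ i → proj₁ (steps i)) , sym-R rcd

  PathEdge : ℕ → (ℕ → V) → Rel V 0ℓ
  PathEdge m f a b = Σ[ p ∈ ℕ ] p < m × SamePair a b (f p) (f (suc p))

  pathEdge-symmetric : ∀ {m f} → Symmetric (PathEdge m f)
  pathEdge-symmetric (p , p<m , e) = p , p<m , SamePair-swap e

  pathEdge-mono : ∀ {q m f} → q ≤ m → ∀ {a b} → PathEdge q f a b → PathEdge m f a b
  pathEdge-mono q≤m (p , p<q , e) = p , <-≤-trans p<q q≤m , e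

  path-walk : ∀ {f p q} → p ≤ q → Star (PathEdge q f) (f p) (f q)
  path-walk {q = zero} z≤n = ε
  path-walk {q = suc q} p≤1+q with m≤n⇒m<n∨m≡n p≤1+q
  ... | inj₂ refl = ε
  ... | inj₁ p<1+q = Star-map (pathEdge-mono (n≤1+n q)) (path-walk (≤-pred p<1+q))
                     ◅◅ return (q , ≤-refl , inj₁ (refl , refl))

  module _ {m : ℕ} {f : ℕ → V} (f-injective : ∀ {p q} → p ≤ m → q ≤ m → f p ≡ f q → p ≡ q) where

    pathEdge-injective : ∀ {p q} → p < m → q < m → SamePair (f p) (f (suc p)) (f q) (f (suc q)) → p ≡ q
    pathEdge-injective p<m q<m (inj₁ (e , _)) = f-injective (<⇒≤ p<m) (<⇒≤ q<m) e
    pathEdge-injective p<m q<m (inj₂ (e₁ , e₂))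
      with refl ← f-injective (<⇒≤ p<m) q<m e₁ | () ← f-injective p<m (<⇒≤ q<m) e₂

    -- A walk from f p avoiding edge p stays among f 0, …, f p.
    pathEdge-no-detour : ∀ {p} → p < m → ¬ Star (PathEdge m f ∖⟨ f p , f (suc p) ⟩) (f p) (f (suc p))
    pathEdge-no-detour {p} p<m detour with Star-transport Below step detour (p , ≤-refl , refl)
      where
        Below : V → Set
        Below x = Σ[ q ∈ ℕ ] q ≤ p × f q ≡ x
        step : ∀ {x y} → (PathEdge m f ∖⟨ f p , f (suc p) ⟩) x y → Below x → Below y
        step ((r , r<m , e) , e≉p) (q , q≤p , refl) with r ≟ p
        ... | yes refl = ⊥-elim (e≉p e)
        ... | no r≢p with e
        ...   | inj₁ (e₁ , e₂) with refl ← f-injective (≤-trans q≤p (<⇒≤ p<m)) (<⇒≤ r<m) e₁ =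
                suc r , ≤∧≢⇒< q≤p r≢p , sym e₂
        ...   | inj₂ (e₁ , e₂) with refl ← f-injective (≤-trans q≤p (<⇒≤ p<m)) r<m e₁ =
                r , <⇒≤ q≤p , sym e₂
    ... | q , q≤p , e with refl ← f-injective (≤-trans q≤p (<⇒≤ p<m)) p<m e = <-irrefl refl q≤p

    path-acyclic : ∀ {c d} → ¬ Bypass (PathEdge m f) c d
    path-acyclic ((p , p<m , inj₁ (refl , refl)) , detour) = pathEdge-no-detour p<m detour
    path-acyclic bypass@((p , p<m , inj₂ (refl , refl)) , _) =
      pathEdge-no-detour p<m (proj₂ (bypass-swap pathEdge-symmetric bypass))

  Separating : (V → Set) → Rel V 0ℓ → Set
  Separating S H = ∀ {x y} → S x → S y → Star H x y → x ≡ y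

  module SeparatedUnion (decide : (P : Set) → Dec P) {S : V → Set} {H P : Rel V 0ℓ}
              (sym-H : Symmetric H) (H-acyclic : ∀ {c d} → ¬ Bypass H c d)
              (H-separating : Separating S H)
              (sym-P : Symmetric P) (P-acyclic : ∀ {c d} → ¬ Bypass P c d)
              (P-in-S : ∀ {a b} → P a b → S a × S b)
              where

    -- P-edges start only at vertices of S, none of which the walk can reach from o.
    stays-on-side : ∀ {c d o} → (∀ {s} → S s → ¬ Star (H ∖⟨ c , d ⟩) o s) →
                    ∀ {x} → Star ((H ∪ P) ∖⟨ c , d ⟩) o x → Star (H ∖⟨ c , d ⟩) o x
    stays-on-side {c} {d} {o} no-S walk = Star-transport (Star (H ∖⟨ c , d ⟩) o) extend walk ε
      where
        extend : ∀ {x y} → ((H ∪ P) ∖⟨ c , d ⟩) x y →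
                 Star (H ∖⟨ c , d ⟩) o x → Star (H ∖⟨ c , d ⟩) o y
        extend (inj₁ h , h≉cd) o⇝x = o⇝x ◅◅ return (h , h≉cd)
        extend (inj₂ p , _)    o⇝x = ⊥-elim (no-S (proj₁ (P-in-S p)) o⇝x)

    -- Removing cd splits the component of cd in H into two sides, and as H is separating at
    -- most one of them contains a vertex of S; start the walk on a side without one.
    H-bypass : ∀ {c d} → H c d → Star ((H ∪ P) ∖⟨ c , d ⟩) c d → Bypass H c d
    H-bypass {c} {d} hcd walk with decide (Σ[ s ∈ V ] S s × Star (H ∖⟨ c , d ⟩) c s)
    ... | no no-S = hcd , stays-on-side (λ Ss c⇝s → no-S (_ , Ss , c⇝s)) walk
    ... | yes (s , Ss , c⇝s) with decide (Σ[ s′ ∈ V ] S s′ × Star (H ∖⟨ c , d ⟩) d s′)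
    ...   | no no-S = hcd , reverse (∖-symmetric sym-H) (stays-on-side (λ Ss d⇝s → no-S (_ , Ss , d⇝s)) walk⁻¹)
      where
        walk⁻¹ : Star ((H ∪ P) ∖⟨ c , d ⟩) d c
        walk⁻¹ = reverse (∖-symmetric (Union.symmetric {L = H} {R = P} sym-H sym-P)) walk
    ...   | yes (s′ , Ss′ , d⇝s′) with H-separating Ss Ss′
                                         (reverse sym-H (Star-map proj₁ c⇝s) ◅◅ hcd ◅ Star-map proj₁ d⇝s′)
    ...     | refl = hcd , c⇝s ◅◅ reverse (∖-symmetric sym-H) d⇝s′

    -- H-walks between vertices of S are trivial, so only the P-steps of the walk matter.
    P-bypass : ∀ {c d} → P c d → Star ((H ∪ P) ∖⟨ c , d ⟩) c d → Bypass P c d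
    P-bypass {c} {d} pcd walk with Star-transport Reach extend walk (c , proj₁ (P-in-S pcd) , ε , ε)
      where
        Reach : V → Set
        Reach x = Σ[ z ∈ V ] S z × Star H x z × Star (P ∖⟨ c , d ⟩) z c
        extend : ∀ {x y} → ((H ∪ P) ∖⟨ c , d ⟩) x y → Reach x → Reach y
        extend (inj₁ h , _) (z , Sz , x⇝z , z⇝c) = z , Sz , sym-H h ◅ x⇝z , z⇝c
        extend (inj₂ p , p≉cd) (z , Sz , x⇝z , z⇝c) with H-separating (proj₁ (P-in-S p)) Sz x⇝z
        ... | refl = _ , proj₂ (P-in-S p) , ε , ∖-symmetric sym-P (p , p≉cd) ◅ z⇝c
    ... | z , Sz , d⇝z , z⇝c with H-separating (proj₂ (P-in-S pcd)) Sz d⇝z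
    ...   | refl = pcd , reverse (∖-symmetric sym-P) z⇝c

    ∪-acyclic : ∀ {c d} → ¬ Bypass (H ∪ P) c d
    ∪-acyclic (inj₁ hcd , walk) = H-acyclic (H-bypass hcd walk)
    ∪-acyclic (inj₂ pcd , walk) = P-acyclic (P-bypass pcd walk)

-- Forests separating a set of vertices

decide : ExcludedMiddle (lsuc 0ℓ) → (P : Set) → Dec P
decide em P = map′ lower lift (em {Lift (lsuc 0ℓ) P})

module _ (em : ExcludedMiddle (lsuc 0ℓ)) (G : Graph) where
  open Graph G

  forest-acyclic : ∀ {H} → IsForest G H → ∀ {c d} → ¬ Bypass H c d
  forest-acyclic (H⊆~ , sym-H , acyclic) bypass =
    acyclic (bypass⇒hasCycle (decide em) (λ {a} h → ~-irr (H⊆~ a a h)) sym-H bypass)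

  module _ (S : V → Set) where

    SeparatingForest : EdgeSet V → Set
    SeparatingForest H = IsForest G H × Separating S H

    IsMaximalSeparatingForest : EdgeSet V → Set₁
    IsMaximalSeparatingForest H =
      SeparatingForest H × (∀ H′ → SeparatingForest H′ → H ⊆ₑ H′ → H′ ⊆ₑ H)

    private
      Candidate : Set₁
      Candidate = Σ[ H ∈ EdgeSet V ] SeparatingForest H

      _⊑_ : Candidate → Candidate → Set
      x ⊑ y = proj₁ x ⊆ₑ proj₁ y

    module ChainUnion (C : Candidate → Set₁) (comparable : ∀ {x y} → C x → C y → (x ⊑ y) ⊎ (y ⊑ x)) where

      InMember : V → V → Set₁
      InMember a b = Σ[ x ∈ Candidate ] C x × proj₁ x a b

      -- Membership in the union is squashed from Set₁ to Set through excluded middle.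
      ⋃ : EdgeSet V
      ⋃ a b = True (em {InMember a b})

      member⊆⋃ : ∀ {x} → C x → proj₁ x ⊆ₑ ⋃
      member⊆⋃ {x} cx a b h = fromWitness (x , cx , h)

      ⋃-member : ∀ {a b} → ⋃ a b → InMember a b
      ⋃-member = toWitness

      walk-in-member : {Fam : Candidate → EdgeSet V} → (∀ {x y} → x ⊑ y → Fam x ⊆ₑ Fam y) →
                       {R : EdgeSet V} → (∀ {a b} → R a b → Σ[ x ∈ Candidate ] C x × Fam x a b) →
                       ∀ {x₀} → C x₀ → ∀ {a b} → Star R a b →
                       Σ[ x ∈ Candidate ] C x × x₀ ⊑ x × Star (Fam x) a b
      walk-in-member mono member c₀ ε = _ , c₀ , (λ _ _ h → h) , ε
      walk-in-member mono member c₀ (r ◅ rs) with member r | walk-in-member mono member c₀ rs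
      ... | x , cx , fr | y , cy , x₀⊑y , walk with comparable cx cy
      ...   | inj₁ x⊑y = y , cy , x₀⊑y , mono x⊑y _ _ fr ◅ walk
      ...   | inj₂ y⊑x = x , cx , (λ a b h → y⊑x a b (x₀⊑y a b h)) , fr ◅ Star-map (mono y⊑x _ _) walk

      ⋃-separatingForest : SeparatingForest ⋃
      ⋃-separatingForest = (⋃⊆~ , sym-⋃ , acyclic) , separating
        where
          ⋃⊆~ : ⋃ ⊆ₑ _~_
          ⋃⊆~ a b u with ⋃-member u
          ... | (_ , (H⊆~ , _) , _) , _ , h = H⊆~ a b h
          sym-⋃ : Symmetric ⋃
          sym-⋃ u with ⋃-member u
          ... | x@(_ , (_ , sym-H , _) , _) , cx , h = member⊆⋃ {x} cx _ _ (sym-H h)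
          acyclic : ¬ HasCycle ⋃
          acyclic cycle with hasCycle⇒bypass sym-⋃ cycle
          ... | c , d , ucd , detour with ⋃-member ucd
          ...   | y , cy , hcd
                with walk-in-member (λ x⊑y a b (h , h≉cd) → x⊑y a b h , h≉cd)
                                    (λ (u , u≉cd) → let (x , cx , h) = ⋃-member u in x , cx , h , u≉cd)
                                    cy detour
          ...     | (_ , forest , _) , _ , y⊑x , walk = forest-acyclic forest (y⊑x c d hcd , walk)
          separating : Separating S ⋃
          separating Sx Sy ε = refl
          separating Sx Sy walk@(u ◅ _) with ⋃-member u
          ... | _ , c₀ , _ with walk-in-member (λ x⊑y → x⊑y) ⋃-member c₀ walk
          ...   | (_ , _ , sep) , _ , _ , walk′ = sep Sx Sy walk′

    -- Opaque: only the existence of H matters, and unfolding its construction is very costly.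
    opaque
      maximalSeparatingForest : Zorn → Σ[ H ∈ EdgeSet V ] IsMaximalSeparatingForest H
      maximalSeparatingForest zorn
        with zorn Candidate _⊑_ (λ _ _ h → h) (λ x⊑y y⊑z a b h → y⊑z a b (x⊑y a b h))
                  ((λ _ _ → ⊥) , empty) upperBound
        where
          empty : SeparatingForest (λ _ _ → ⊥)
          empty = ((λ _ _ ()) , (λ ()) , λ cycle → proj₁ (proj₂ (proj₂ (hasCycle⇒bypass (λ ()) cycle))))
                , λ { _ _ ε → refl }
          upperBound : (C : Candidate → Set₁) → (∀ {x y} → C x → C y → (x ⊑ y) ⊎ (y ⊑ x)) →
                       Σ[ u ∈ Candidate ] (∀ {x} → C x → x ⊑ u)
          upperBound C comparable = (ChainUnion.⋃ C comparable , ChainUnion.⋃-separatingForest C comparable)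
                                  , ChainUnion.member⊆⋃ C comparable
      ... | (H , separatingForest) , maximal = H , separatingForest , λ H′ sH′ → maximal (H′ , sH′)

-- Indices modulo the length of the cycle

module CycleIndexing {V : Set} (m : ℕ) (v : Fin (suc m) → V) (v-injective : Injective _≡_ _≡_ v) where

  n : ℕ
  n = suc m

  -- Opaque, so that unification can read off a and b from w a ≡ w b.
  opaque
    w : ℕ → V
    w k = v (k mod n)

    w-toℕ : ∀ i → w (toℕ i) ≡ v i
    w-toℕ i = cong v (toℕ-injective (trans (toℕ-fromℕ< _) (m<n⇒m%n≡m (toℕ<n i))))

    w-cong : ∀ {a b} → a % n ≡ b % n → w a ≡ w b
    w-cong e = cong v (toℕ-injective (trans (toℕ-fromℕ< _) (trans e (sym (toℕ-fromℕ< _)))))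

    w-% : ∀ {a b} → w a ≡ w b → a % n ≡ b % n
    w-% e = trans (sym (toℕ-fromℕ< _)) (trans (cong toℕ (v-injective e)) (toℕ-fromℕ< _))

  w-injective-< : ∀ {a b} → a < n → b < n → w a ≡ w b → a ≡ b
  w-injective-< a<n b<n e = trans (sym (m<n⇒m%n≡m a<n)) (trans (w-% e) (m<n⇒m%n≡m b<n))

  w-periodic : ∀ a → w (a + n) ≡ w a
  w-periodic a = w-cong ([m+n]%n≡m%n a n)

  w-reduce : ∀ a → w (a % n) ≡ w a
  w-reduce a = w-cong (m%n%n≡m%n a n)

  w-shiftˡ : ∀ c {a b} → w a ≡ w b → w (c + a) ≡ w (c + b)
  w-shiftˡ c {a} {b} e = w-cong (begin
    (c + a) % n             ≡⟨ %-distribˡ-+ c a n ⟩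
    (c % n + a % n) % n     ≡⟨ cong (λ r → (c % n + r) % n) (w-% e) ⟩
    (c % n + b % n) % n     ≡⟨ %-distribˡ-+ c b n ⟨
    (c + b) % n             ∎)
    where open ≡-Reasoning

  w-shiftʳ : ∀ c {a b} → w a ≡ w b → w (a + c) ≡ w (b + c)
  w-shiftʳ c {a} {b} e = subst₂ (λ x y → w x ≡ w y) (+-comm c a) (+-comm c b) (w-shiftˡ c e)

  w-offset-surjective : ∀ l k → Σ[ p ∈ ℕ ] p < n × w (l + p) ≡ w k
  w-offset-surjective l k = x % n , m%n<n x n , (begin
    w (l + x % n)        ≡⟨ w-shiftʳ (x % n) (w-reduce l) ⟨
    w (r + x % n)        ≡⟨ w-shiftˡ r (w-reduce x) ⟩
    w (r + x)            ≡⟨ cong w (r+x≡k+n) ⟩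
    w (k + n)            ≡⟨ w-periodic k ⟩
    w k                  ∎)
    where
      open ≡-Reasoning
      r = l % n
      x = k + (n ∸ r)
      r+x≡k+n : r + x ≡ k + n
      r+x≡k+n = begin
        r + (k + (n ∸ r))   ≡⟨ +-comm r _ ⟩
        k + (n ∸ r) + r     ≡⟨ +-assoc k _ r ⟩
        k + ((n ∸ r) + r)   ≡⟨ cong (k +_) (m∸n+n≡m (<⇒≤ (m%n<n l n))) ⟩
        k + n               ∎

  w-cancelˡ : ∀ l {p q} → w (l + p) ≡ w (l + q) → w p ≡ w q
  w-cancelˡ l {p} {q} e = trans (sym (from-offset p)) (trans (w-shiftˡ c e) (from-offset q))
    where
      open ≡-Reasoning
      c = proj₁ (w-offset-surjective l 0)
      from-offset : ∀ a → w (c + (l + a)) ≡ w a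
      from-offset a = begin
        w (c + (l + a))   ≡⟨ cong w (trans (sym (+-assoc c l a)) (cong (_+ a) (+-comm c l))) ⟩
        w (l + c + a)     ≡⟨ w-shiftʳ a (proj₂ (proj₂ (w-offset-surjective l 0))) ⟩
        w (0 + a)         ∎

  CycleVertex : V → Set
  CycleVertex x = Σ[ k ∈ ℕ ] w k ≡ x

  CycleEdge : ℕ → Rel V 0ℓ
  CycleEdge k a b = SamePair a b (w k) (w (suc k))

  CycleMinus : ℕ → Rel V 0ℓ
  CycleMinus t a b = Σ[ k ∈ ℕ ] k < n × k ≢ t × CycleEdge k a b

  cycleEdge-vertices : ∀ {k a b} → CycleEdge k a b → CycleVertex a × CycleVertex b
  cycleEdge-vertices {k} (inj₁ (refl , refl)) = (k , refl) , (suc k , refl)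
  cycleEdge-vertices {k} (inj₂ (refl , refl)) = (suc k , refl) , (k , refl)

  cycleEdge-injective : 2 ≤ m → ∀ {k l} → k < n → l < n → CycleEdge l (w k) (w (suc k)) → k ≡ l
  cycleEdge-injective _ k<n l<n (inj₁ (e , _)) = w-injective-< k<n l<n e
  cycleEdge-injective 2≤m {k} {l} k<n l<n (inj₂ (e₁ , e₂)) =
    ⊥-elim (1+n≢0 (w-injective-< (s≤s 2≤m) (s≤s z≤n) w2≡w0))
    where
      open ≡-Reasoning
      w2≡w0 : w 2 ≡ w 0
      w2≡w0 = w-cancelˡ k (begin
        w (k + 2)     ≡⟨ cong w (+-comm k 2) ⟩
        w (suc (suc k)) ≡⟨ w-shiftˡ 1 e₂ ⟩
        w (suc l)     ≡⟨ e₁ ⟨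
        w k           ≡⟨ cong w (+-identityʳ k) ⟨
        w (k + 0)     ∎)

  cycle⇒cycleEdges : {R : Rel V 0ℓ} → (∀ (i : Fin m) → R (v (inject₁ i)) (v (fsuc i))) →
                     R (v (fromℕ m)) (v fzero) →
                     ∀ k → k < n → R (w k) (w (suc k))
  cycle⇒cycleEdges {R} steps closing k k<n with m≤n⇒m<n∨m≡n (≤-pred k<n)
  ... | inj₁ k<m = subst₂ R (sym (trans (cong w (trans k≡i (sym (toℕ-inject₁ i)))) (w-toℕ (inject₁ i))))
                             (sym (trans (cong w (cong suc k≡i)) (w-toℕ (fsuc i))))
                             (steps i)
    where
      i = fromℕ< k<m
      k≡i : k ≡ toℕ i
      k≡i = sym (toℕ-fromℕ< k<m)
  ... | inj₂ refl = subst₂ R (sym (trans (cong w (sym (toℕ-fromℕ m))) (w-toℕ (fromℕ m))))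
                             (sym (trans (w-periodic 0) (w-toℕ fzero)))
                             closing

  cycleEdges⇒hasCycle : {R : Rel V 0ℓ} → 2 ≤ m → (∀ k → k < n → R (w k) (w (suc k))) → HasCycle R
  cycleEdges⇒hasCycle {R} 2≤m edge = n , s≤s 2≤m , v , v-injective , steps , closing
    where
      steps : ∀ (i : Fin m) → R (v (inject₁ i)) (v (fsuc i))
      steps i = subst₂ R (trans (cong w (sym (toℕ-inject₁ i))) (w-toℕ (inject₁ i))) (w-toℕ (fsuc i))
                         (edge (toℕ i) (s≤s (<⇒≤ (toℕ<n i))))
      closing : R (v (fromℕ m)) (v fzero)
      closing = subst₂ R (trans (cong w (sym (toℕ-fromℕ m))) (w-toℕ (fromℕ m)))
                         (trans (w-periodic 0) (w-toℕ fzero))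
                         (edge m ≤-refl)

  -- Removing edge t leaves the path w (t + 1), w (t + 2), …, w (t + n).
  rotated : ℕ → ℕ → V
  rotated t p = w (suc t + p)

  rotated-injective : ∀ t {p q} → p ≤ m → q ≤ m → rotated t p ≡ rotated t q → p ≡ q
  rotated-injective t p≤m q≤m e = w-injective-< (s≤s p≤m) (s≤s q≤m) (w-cancelˡ (suc t) e)

  rotated-covers : ∀ t {x} → CycleVertex x → Σ[ p ∈ ℕ ] p ≤ m × rotated t p ≡ x
  rotated-covers t (k , refl) with w-offset-surjective (suc t) k
  ... | p , p<n , e = p , ≤-pred p<n , e

  pathEdge⇒cycleMinus : ∀ {t} → t < n → ∀ {a b} → PathEdge m (rotated t) a b → CycleMinus t a b
  pathEdge⇒cycleMinus {t} t<n (p , p<m , e) =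
    k , m%n<n (suc t + p) n , k≢t , subst₂ (SamePair _ _) (sym (w-reduce _)) (sym wsk) e
    where
      open ≡-Reasoning
      k = (suc t + p) % n
      wsk : w (suc k) ≡ w (suc t + suc p)
      wsk = trans (w-shiftˡ 1 (w-reduce _)) (cong w (sym (+-suc (suc t) p)))
      k≢t : k ≢ t
      k≢t k≡t = 1+n≢0 (w-injective-< (s≤s p<m) (s≤s z≤n) (w-cancelˡ t (begin
        w (t + suc p)   ≡⟨ cong w (+-suc t p) ⟩
        w (suc t + p)   ≡⟨ w-reduce _ ⟨
        w k             ≡⟨ cong w k≡t ⟩
        w t             ≡⟨ cong w (+-identityʳ t) ⟨
        w (t + 0)       ∎)))

  cycleMinus⇒pathEdge : ∀ {t} → t < n → ∀ {a b} → CycleMinus t a b → PathEdge m (rotated t) a b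
  cycleMinus⇒pathEdge {t} t<n (k , k<n , k≢t , e) with w-offset-surjective (suc t) k
  ... | p , p<n , wp≡wk = p , p<m , subst₂ (SamePair _ _) (sym wp≡wk) (sym wsp) e
    where
      open ≡-Reasoning
      wsp : w (suc t + suc p) ≡ w (suc k)
      wsp = trans (cong w (+-suc (suc t) p)) (w-shiftˡ 1 wp≡wk)
      p<m : p < m
      p<m = ≤∧≢⇒< (≤-pred p<n) λ { refl → k≢t (w-injective-< k<n t<n (begin
        w k             ≡⟨ wp≡wk ⟨
        w (suc t + m)   ≡⟨ cong w (+-suc t m) ⟨
        w (t + n)       ≡⟨ w-periodic t ⟩
        w t             ∎)) }

  cycleMinus-symmetric : ∀ {t} → Symmetric (CycleMinus t)
  cycleMinus-symmetric (k , k<n , k≢t , e) = k , k<n , k≢t , SamePair-swap e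

  cycleMinus-acyclic : ∀ {t} → t < n → ∀ {c d} → ¬ Bypass (CycleMinus t) c d
  cycleMinus-acyclic {t} t<n = path-acyclic (rotated-injective t) ∘ bypass-mono (cycleMinus⇒pathEdge t<n)

-- The n maximal forests H ∪ (C − e_t)

module Construction (em : ExcludedMiddle (lsuc 0ℓ)) (zorn : Zorn) (G : Graph) (m : ℕ) (2≤m : 2 ≤ m)
  (v : Fin (suc m) → Graph.V G) (v-injective : Injective _≡_ _≡_ v)
  (steps : ∀ (i : Fin m) → Graph._~_ G (v (inject₁ i)) (v (fsuc i)))
  (closing : Graph._~_ G (v (fromℕ m)) (v fzero)) where

  open Graph G
  open CycleIndexing m v v-injective

  cycleEdge-~ : ∀ {k a b} → k < n → CycleEdge k a b → a ~ b
  cycleEdge-~ {k} k<n = SamePair-transport {R = _~_} ~-sym (cycle⇒cycleEdges {R = _~_} steps closing k k<n)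

  private
    maximal : Σ[ H ∈ EdgeSet V ] IsMaximalSeparatingForest em G CycleVertex H
    maximal = maximalSeparatingForest em G CycleVertex zorn

  H : EdgeSet V
  H = proj₁ maximal

  H-forest : IsForest G H
  H-forest = proj₁ (proj₁ (proj₂ maximal))

  H⊆~ : H ⊆ₑ _~_
  H⊆~ = proj₁ H-forest

  sym-H : Symmetric H
  sym-H = proj₁ (proj₂ H-forest)

  H-separating : Separating CycleVertex H
  H-separating = proj₂ (proj₁ (proj₂ maximal))

  H-maximal : ∀ H′ → SeparatingForest em G CycleVertex H′ → H ⊆ₑ H′ → H′ ⊆ₑ H
  H-maximal = proj₂ (proj₂ maximal)

  H-avoids-cycle : ∀ {k a b} → H a b → ¬ CycleEdge k a b
  H-avoids-cycle {a = a} h e with ca , cb ← cycleEdge-vertices e =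
    ~-irr (H⊆~ a a (subst (H a) (sym (H-separating ca cb (h ◅ ε))) h))

  T : ℕ → EdgeSet V
  T t = H ∪ CycleMinus t

  sym-T : ∀ {t} → Symmetric (T t)
  sym-T {t} = Union.symmetric {L = H} {R = CycleMinus t} sym-H cycleMinus-symmetric

  T-forest : ∀ {t} → t < n → IsForest G (T t)
  T-forest {t} t<n = T⊆~ , sym-T , λ cycle → ∪-acyclic (proj₂ (proj₂ (hasCycle⇒bypass sym-T cycle)))
    where
      open SeparatedUnion (decide em) sym-H (forest-acyclic em G H-forest) H-separating
                          cycleMinus-symmetric (cycleMinus-acyclic t<n) (λ (_ , _ , _ , e) → cycleEdge-vertices e)
      T⊆~ : T t ⊆ₑ _~_
      T⊆~ a b (inj₁ h) = H⊆~ a b h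
      T⊆~ a b (inj₂ (k , k<n , _ , e)) = cycleEdge-~ k<n e

  -- An edge ab of a forest F ⊇ T t outside T t would make H + ab a larger separating forest.
  module _ {t} (t<n : t < n) {F} (F-forest : IsForest G F) (T⊆F : T t ⊆ₑ F)
           {a b} (Fab : F a b) (ab∉T : ¬ T t a b) where

    sym-F : Symmetric F
    sym-F = proj₁ (proj₂ F-forest)

    F-acyclic : ¬ HasCycle F
    F-acyclic = proj₂ (proj₂ F-forest)

    H⁺ : EdgeSet V
    H⁺ x y = H x y ⊎ SamePair x y a b

    H⁺⊆F : H⁺ ⊆ₑ F
    H⁺⊆F x y (inj₁ h) = T⊆F x y (inj₁ h)
    H⁺⊆F x y (inj₂ e) = SamePair-transport sym-F Fab e

    -- ab is not edge t either, since F would then contain the whole cycle.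
    ab-avoids-cycle : ∀ {k} → k < n → ¬ CycleEdge k a b
    ab-avoids-cycle {k} k<n e with k ≟ t
    ... | no k≢t = ab∉T (inj₂ (k , k<n , k≢t , e))
    ... | yes refl = F-acyclic (cycleEdges⇒hasCycle 2≤m cycle-in-F)
      where
        cycle-in-F : ∀ l → l < n → F (w l) (w (suc l))
        cycle-in-F l l<n with l ≟ k
        ... | yes refl = SamePair-transport sym-F Fab (SamePair-sym e)
        ... | no l≢k = T⊆F _ _ (inj₂ (l , l<n , l≢k , inj₁ (refl , refl)))

    H⁺-avoids-cycle : ∀ {k x y} → k < n → H⁺ x y → ¬ CycleEdge k x y
    H⁺-avoids-cycle k<n (inj₁ h) = H-avoids-cycle h
    H⁺-avoids-cycle k<n (inj₂ e) e′ = ab-avoids-cycle k<n (SamePair-trans (SamePair-sym e) e′)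

    -- Closing such a walk with the path of T t between its ends gives a cycle in F.
    no-H⁺-walk-along : ∀ {p q} → p < q → q ≤ m → ¬ Star H⁺ (rotated t p) (rotated t q)
    no-H⁺-walk-along {p} {suc q} (s≤s p≤q) q<m walk with pathEdge⇒cycleMinus t<n (q , q<m , inj₁ (refl , refl))
    ... | edge@(k , k<n , _ , e) = forest-acyclic em G F-forest (T⊆F _ _ (inj₂ edge) , detour)
      where
        along-path : Star (F ∖⟨ rotated t q , rotated t (suc q) ⟩) (rotated t q) (rotated t p)
        along-path = reverse (∖-symmetric sym-F) (Star-map (λ {x} {y} f@(r , r<q , e′) →
            T⊆F x y (inj₂ (pathEdge⇒cycleMinus t<n (pathEdge-mono (<⇒≤ q<m) f))) ,
            λ e″ → <⇒≢ r<q (pathEdge-injective (rotated-injective t) (<-trans r<q q<m) q<m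
                                                (SamePair-trans (SamePair-sym e′) e″)))
          (path-walk p≤q))
        detour : Star (F ∖⟨ rotated t q , rotated t (suc q) ⟩) (rotated t q) (rotated t (suc q))
        detour = along-path ◅◅ Star-map (λ {x} {y} h → H⁺⊆F x y h ,
                                                        λ e′ → H⁺-avoids-cycle k<n h (SamePair-trans e′ e)) walk

    H⁺-separatingForest : SeparatingForest em G CycleVertex H⁺
    H⁺-separatingForest = (H⁺⊆~ , sym-H⁺ , λ cycle → F-acyclic (hasCycle-mono H⁺⊆F cycle)) , separating
      where
        H⁺⊆~ : H⁺ ⊆ₑ _~_
        H⁺⊆~ x y h = proj₁ F-forest x y (H⁺⊆F x y h)
        sym-H⁺ : Symmetric H⁺
        sym-H⁺ (inj₁ h) = inj₁ (sym-H h)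
        sym-H⁺ (inj₂ e) = inj₂ (SamePair-swap e)
        separating : Separating CycleVertex H⁺
        separating cx cy walk with rotated-covers t cx | rotated-covers t cy
        ... | p , p≤m , refl | q , q≤m , refl with <-cmp p q
        ...   | tri≈ _ refl _ = refl
        ...   | tri< p<q _ _ = ⊥-elim (no-H⁺-walk-along p<q q≤m walk)
        ...   | tri> _ _ q<p = ⊥-elim (no-H⁺-walk-along q<p p≤m (reverse sym-H⁺ walk))

    ab∈H : H a b
    ab∈H = H-maximal H⁺ H⁺-separatingForest (λ _ _ → inj₁) a b (inj₂ (inj₁ (refl , refl)))

  T-maximal : ∀ {t} → t < n → ∀ F → IsForest G F → T t ⊆ₑ F → F ⊆ₑ T t
  T-maximal t<n F F-forest T⊆F a b Fab with decide em (T _ a b)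
  ... | yes ab∈T = ab∈T
  ... | no ab∉T = inj₁ (ab∈H t<n F-forest T⊆F Fab ab∉T)

  cycleEdge∈T : ∀ {s t} → s < n → s ≢ t → T t (w s) (w (suc s))
  cycleEdge∈T s<n s≢t = inj₂ (_ , s<n , s≢t , inj₁ (refl , refl))

  cycleEdge∉T : ∀ {t} → t < n → ¬ T t (w t) (w (suc t))
  cycleEdge∉T t<n (inj₁ h) = H-avoids-cycle h (inj₁ (refl , refl))
  cycleEdge∉T t<n (inj₂ (k , k<n , k≢t , e)) = k≢t (sym (cycleEdge-injective 2≤m t<n k<n e))

  T-exchange : ∀ {s t} → s < n → t < n → s ≢ t → ∀ a b →
               T s a b ⇔ ((T t a b × ¬ SamePair a b (w s) (w (suc s))) ⊎ SamePair a b (w t) (w (suc t)))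
  T-exchange {s} {t} s<n t<n s≢t a b = mk⇔ to from
    where
      to : T s a b → (T t a b × ¬ SamePair a b (w s) (w (suc s))) ⊎ SamePair a b (w t) (w (suc t))
      to (inj₁ h) = inj₁ (inj₁ h , H-avoids-cycle h)
      to (inj₂ (k , k<n , k≢s , e)) with k ≟ t
      ... | yes refl = inj₂ e
      ... | no k≢t = inj₁ (inj₂ (k , k<n , k≢t , e) ,
                           λ e′ → k≢s (cycleEdge-injective 2≤m k<n s<n (SamePair-trans (SamePair-sym e) e′)))
      from : (T t a b × ¬ SamePair a b (w s) (w (suc s))) ⊎ SamePair a b (w t) (w (suc t)) → T s a b
      from (inj₁ (inj₁ h , _)) = inj₁ h
      from (inj₁ (inj₂ (k , k<n , k≢t , e) , e≉s)) = inj₂ (k , k<n , (λ { refl → e≉s e }) , e)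
      from (inj₂ e) = inj₂ (t , t<n , s≢t ∘ sym , e)

  T-distinct : ∀ {s t} → t < n → s ≢ t → ¬ (T s ≐ₑ T t)
  T-distinct t<n s≢t Ts≐Tt = cycleEdge∉T t<n (Equivalence.to (Ts≐Tt _ _) (cycleEdge∈T t<n (s≢t ∘ sym)))

  T-adjacent : ∀ {s t} → s < n → t < n → s ≢ t → ForestAdj G (T s) (T t)
  T-adjacent {s} {t} s<n t<n s≢t =
    w t , w (suc t) , w s , w (suc s) ,
    cycleEdge∈T t<n (s≢t ∘ sym) , cycleEdge-~ s<n (inj₁ (refl , refl)) , cycleEdge∉T s<n ,
    T-exchange t<n s<n (s≢t ∘ sym)

lemma2p8 : ExcludedMiddle (lsuc 0ℓ) → Zorn →
    (G : Graph) (n : ℕ) → 3 ≤ n → CycleOfLength (Graph._~_ G) n →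
    ForestGraphContainsK G n
lemma2p8 em zorn G (suc m) (s≤s 2≤m) (v , v-injective , steps , closing) =
  T ∘ toℕ ,
  (λ i → T-forest (toℕ<n i) , T-maximal (toℕ<n i)) ,
  (λ i j i≢j → T-distinct (toℕ<n j) (toℕ-≢ i≢j)) ,
  (λ i j i≢j → T-adjacent (toℕ<n i) (toℕ<n j) (toℕ-≢ i≢j))
  where
    open Construction em zorn G m 2≤m v v-injective steps closing
    toℕ-≢ : ∀ {i j : Fin (suc m)} → i ≢ j → toℕ i ≢ toℕ j
    toℕ-≢ i≢j = i≢j ∘ toℕ-injective
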